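{- Let $n\ge1$, $\mathbf f=(f_1,\dots,f_n)$ with $1\le f_1\le\cdots\le f_n\le n$ and $\mathcal D_{n,\mathbf f}\ne\emptyset$, and $H(\mathbf f)=(h_1,\dots,h_n)$. In $\mathbb{Z}[\mathcal D_n]$ let $\Theta_1=1$ and for $2\le j\le n$, $\Theta_j=1+\sum_{i=h_j}^{j-1}t^D_{ij}+\sum_{i=h_j}^{j}t^D_{\bar i j}$. Then $\Theta_1\Theta_2\cdots\Theta_n=\sum_{\pi\in\mathcal D_{n,\mathbf f}}\pi$.
   Context: $\mathcal D_n$: group under composition of signed permutations $\pi$ of $\{\pm1,\dots,\pm n\}$ ($\pi(-i)=-\pi(i)$) with an even number of $i\in[n]$ having $\pi(i)<0$; window $\pi_1\cdots\pi_n$, $\pi_i=\pi(i)$; $\bar i=-i$. $\mathcal D_{n,\mathbf f}=\{\pi:|\pi_i|\le f_i\ \forall i\}$; $h_j$ is the smallest index $i$ such that some $\pi\in\mathcal D_{n,\mathbf f}$ has $|\pi_i|=j$. For $1\le|i|<j\le n$, $t^D_{ij}$ is the signed permutation with $t(i)=j$, $t(j)=i$ (so $t(-i)=-j$, $t(-j)=-i$) fixing all other elements; in particular $t^D_{\bar i j}$ ($1\le i<j$) maps $i\mapsto -j$, $j\mapsto -i$. For $1<j\le n$, $t^D_{\bar j j}$ negates $1$ and $j$ and fixes the other elements of $[n]$. -}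

module Defs where

open import Data.Nat using (ℕ; zero; suc; _≤_; _<_; _∸_; _+_)
open import Data.Nat.Divisibility using (_∣_)
open import Data.Integer using (ℤ; +_; -[1+_]; -_; ∣_∣; _*_; _<?_) renaming (_+_ to _+ℤ_)
import Data.Integer.Properties as ℤP
open import Data.Fin using (Fin; toℕ)
open import Data.Vec using (Vec; []; _∷_; lookup; map; tabulate)
import Data.Vec.Properties as VecP
open import Data.List using (List; concatMap) renaming ([] to []ᴸ; _∷_ to _∷ᴸ_; map to mapᴸ; _++_ to _++ᴸ_; foldr to foldrᴸ)
open import Data.Product using (_×_; _,_; ∃)
open import Relation.Nullary using (¬_; yes; no)
open import Relation.Nullary.Decidable using (⌊_⌋)
open import Relation.Binary.PropositionalEquality using (_≡_; _≢_)
open import Data.Bool using (Bool; true; false; if_then_else_)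

-- A window π₁ ⋯ πₙ of a (candidate) signed permutation of {±1,…,±n}.
Window : ℕ → Set
Window n = Vec ℤ n

-- 0-based lookup on a window, returning 0 out of range.
lookupℕ : ∀ {n} → Window n → ℕ → ℤ
lookupℕ []       _       = + 0
lookupℕ (x ∷ xs) zero    = x
lookupℕ (x ∷ xs) (suc m) = lookupℕ xs m

-- 1-based entry πᵢ of the window (i ≥ 1).
entry : ∀ {n} → Window n → ℕ → ℤ
entry π i = lookupℕ π (i ∸ 1)

apply : ∀ {n} → Window n → ℤ → ℤ
apply π (+ zero)   = + 0
apply π (+ suc m)  = lookupℕ π m
apply π -[1+ m ]   = - lookupℕ π m

IsSignedPerm : ∀ {n} → Window n → Set
IsSignedPerm {n} π =
  (∀ (i : Fin n) → 1 ≤ ∣ lookup π i ∣ × ∣ lookup π i ∣ ≤ n) ×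
  (∀ (i j : Fin n) → ∣ lookup π i ∣ ≡ ∣ lookup π j ∣ → i ≡ j)

isNeg : ℤ → Bool
isNeg x = ⌊ x <? + 0 ⌋

negCount : ∀ {n} → Window n → ℕ
negCount []       = 0
negCount (x ∷ xs) = (if isNeg x then 1 else 0) + negCount xs

InD : ∀ {n} → Window n → Set
InD π = IsSignedPerm π × (2 ∣ negCount π)

InDf : ∀ {n} → Vec ℕ n → Window n → Set
InDf f π = InD π × (∀ i → ∣ lookup π i ∣ ≤ lookup f i)

_∘D_ : ∀ {n} → Window n → Window n → Window n
π ∘D σ = map (apply π) σ

idD : ∀ n → Window n
idD n = tabulate (λ (k : Fin n) → + suc (toℕ k))

swapVal : ℤ → ℤ → ℤ → ℤ
swapVal a b x with x ℤP.≟ a | x ℤP.≟ b | x ℤP.≟ - a | x ℤP.≟ - b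
... | yes _ | _     | _     | _     = b
... | no _  | yes _ | _     | _     = a
... | no _  | no _  | yes _ | _     = - b
... | no _  | no _  | no _  | yes _ = - a
... | no _  | no _  | no _  | no _  = x

tD : ∀ n → ℕ → ℕ → Window n
tD n i j = tabulate (λ (k : Fin n) → swapVal (+ i) (+ j) (+ suc (toℕ k)))

-- window of t^D_{ī j} : for i < j, i ↦ -j, j ↦ -i;
-- for i = j (j > 1), t^D_{j̄ j} negates 1 and j and fixes the rest
tDbar : ∀ n → ℕ → ℕ → Window n
tDbar n i j with i Data.Nat.≟ j
... | no _  = tabulate (λ (k : Fin n) → swapVal (- (+ i)) (+ j) (+ suc (toℕ k)))
... | yes _ = tabulate (λ (k : Fin n) →
                 if ⌊ suc (toℕ k) Data.Nat.≟ 1 ⌋ then - (+ suc (toℕ k))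
                 else if ⌊ suc (toℕ k) Data.Nat.≟ j ⌋ then - (+ suc (toℕ k))
                 else + suc (toℕ k))

-- Elements of the group ring ℤ[𝒟ₙ] as finite formal sums Σ c·π
ZD : ℕ → Set
ZD n = List (ℤ × Window n)

oneZD : ∀ n → ZD n
oneZD n = (+ 1 , idD n) ∷ᴸ []ᴸ

_*ZD_ : ∀ {n} → ZD n → ZD n → ZD n
x *ZD y = concatMap (λ { (a , π) → mapᴸ (λ { (b , σ) → (a * b , π ∘D σ) }) y }) x

coeff : ∀ {n} → ZD n → Window n → ℤ
coeff []ᴸ            π = + 0
coeff ((a , σ) ∷ᴸ x) π with VecP.≡-dec ℤP._≟_ σ π
... | yes _ = a +ℤ coeff x π
... | no _  = coeff x π

interval : ℕ → ℕ → List ℕ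
interval a b = go (suc b ∸ a) a
  where
  go : ℕ → ℕ → List ℕ
  go zero    _ = []ᴸ
  go (suc k) m = m ∷ᴸ go k (suc m)

Θ : ∀ n → (ℕ → ℕ) → ℕ → ZD n
Θ n h zero          = oneZD n
Θ n h (suc zero)    = oneZD n
Θ n h j@(suc (suc _)) =
  (+ 1 , idD n) ∷ᴸ
  (mapᴸ (λ i → (+ 1 , tD n i j)) (interval (h j) (j ∸ 1)) ++ᴸ
   mapᴸ (λ i → (+ 1 , tDbar n i j)) (interval (h j) j))

ΘProd : ∀ n → (ℕ → ℕ) → ZD n
ΘProd n h = foldrᴸ (λ j acc → Θ n h j *ZD acc) (oneZD n) (interval 1 n)

IsH : ∀ n → Vec ℕ n → (ℕ → ℕ) → Set
IsH n f h = ∀ j → 1 ≤ j → j ≤ n →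
  (1 ≤ h j × h j ≤ n × ∃ (λ π → InDf f π × ∣ entry π (h j) ∣ ≡ j)) ×
  (∀ i → 1 ≤ i → i < h j → ∀ π → InDf f π → ∣ entry π i ∣ ≢ j)

-- Let Pₖ = Θ₁ ⋯ Θₖ. By induction on k, the coefficient of σ in Pₖ is 1 when σ ∈ 𝒟_{n,f} fixes
-- k+1, …, n and 0 otherwise; k = n is the theorem. For k = 1 only the identity qualifies: σ(1) = ±1,
-- and the sign is forced by the parity of the number of negative entries.
--
-- Every term τ of Θ_{k+1} is an involution exchanging position k+1 with some position p ≥ h_{k+1}
-- (with signs, keeping an even number of them negative), so the coefficient of π in Pₖ Θ_{k+1} is
-- Σ_τ [Pₖ](π τ). If π ∈ 𝒟_{n,f} fixes k+2, …, n, then ±(k+1) sits at a position p with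
-- h_{k+1} ≤ p ≤ k+1, and exactly one τ (the one for p and that sign) moves +(k+1) to position k+1;
-- π τ then fixes k+1, …, n and stays in 𝒟_{n,f} because f is monotone. For any other τ, π τ does
-- not fix k+1. Conversely, if π τ lies in 𝒟_{n,f} and fixes k+1, …, n for some term τ, then π lies
-- in 𝒟_{n,f} and fixes k+2, …, n: the value k+1 lands at position p, and k+1 ≤ f_{h_{k+1}} ≤ f_p
-- by the definition of h_{k+1}.

module Submission where

open import Data.Bool using (Bool; true; false; _∨_; if_then_else_)
open import Data.Empty using (⊥-elim)
open import Data.Fin using (Fin; toℕ; fromℕ<) renaming (zero to fzero; suc to fsuc)
import Data.Fin.Properties as Finₚ
open import Data.Integer using (ℤ; +_; -[1+_]; -_; ∣_∣) renaming (_+_ to _+ℤ_; _*_ to _*ℤ_)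
import Data.Integer.Properties as ℤₚ
open import Data.List using (List; []; _∷_; _++_; [_]; foldr) renaming (map to mapᴸ)
import Data.List.Properties as Listₚ
open import Data.List.Relation.Unary.All as All using (All; []; _∷_)
import Data.List.Relation.Unary.All.Properties as Allₚ
open import Data.Nat using (ℕ; zero; suc; _+_; _*_; _∸_; _≤_; _<_; _≟_; _≤?_; _<?_; z≤n; s≤s)
import Data.Nat.Properties as ℕₚ
open import Data.Nat.Divisibility using (_∣_; divides; ∣1⇒≡1; ∣m+n∣m⇒∣n; ∣m∣n⇒∣m+n; ∣-refl)
open import Data.Product using (_×_; _,_; proj₁; proj₂; ∃; ∃₂)
open import Data.Sum using (_⊎_; inj₁; inj₂)
open import Data.Vec using (Vec; []; _∷_; lookup; tabulate) renaming (map to mapⱽ)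
import Data.Vec.Properties as Vecₚ
open import Function using (_∘_; id)
open import Relation.Binary.PropositionalEquality hiding ([_])
open import Relation.Nullary using (¬_; yes; no)
open import Relation.Nullary.Decidable using (⌊_⌋)

open import Algebra.Properties.CommutativeSemigroup ℕₚ.+-commutativeSemigroup
  using (x∙yz≈xz∙y; xy∙z≈zy∙x; xy∙z≈xz∙y) renaming (interchange to +-interchange)
open import Algebra.Properties.CommutativeSemigroup ℤₚ.+-commutativeSemigroup
  using () renaming (interchange to +ℤ-interchange)

open import Defs

-- Windows as functions of 0-based positions

infixl 9 _!_

_!_ : ∀ {n} → Window n → ℕ → ℤ
_!_ = lookupℕ

_!ℕ_ : ∀ {n} → Vec ℕ n → ℕ → ℕ
[]      !ℕ _     = 0
(x ∷ _) !ℕ zero  = x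
(_ ∷ v) !ℕ suc m = v !ℕ m

lookup≡!ℕ : ∀ {n} (v : Vec ℕ n) (i : Fin n) → lookup v i ≡ v !ℕ toℕ i
lookup≡!ℕ (x ∷ v) fzero    = refl
lookup≡!ℕ (x ∷ v) (fsuc i) = lookup≡!ℕ v i

!-map : ∀ {n} (g : ℤ → ℤ) → g (+ 0) ≡ + 0 → (v : Window n) (m : ℕ) → mapⱽ g v ! m ≡ g (v ! m)
!-map g g0 []      m       = sym g0
!-map g g0 (x ∷ v) zero    = refl
!-map g g0 (x ∷ v) (suc m) = !-map g g0 v m

!-tabulate : ∀ {n} (G : ℕ → ℤ) m → m < n → tabulate {n = n} (G ∘ toℕ) ! m ≡ G m
!-tabulate {suc n} G zero    _         = refl
!-tabulate {suc n} G (suc m) (s≤s m<n) = !-tabulate {n} (G ∘ suc) m m<n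

lookup≡! : ∀ {n} (v : Window n) (i : Fin n) → lookup v i ≡ v ! toℕ i
lookup≡! (x ∷ v) fzero    = refl
lookup≡! (x ∷ v) (fsuc i) = lookup≡! v i

!-ext : ∀ {n} (u v : Window n) → (∀ m → m < n → u ! m ≡ v ! m) → u ≡ v
!-ext []      []      _  = refl
!-ext (x ∷ u) (y ∷ v) eq =
  cong₂ _∷_ (eq 0 (s≤s z≤n)) (!-ext u v (λ m m<n → eq (suc m) (s≤s m<n)))

apply-neg : ∀ {n} (π : Window n) x → apply π (- x) ≡ - apply π x
apply-neg π (+ zero)  = refl
apply-neg π (+ suc m) = refl
apply-neg π -[1+ m ]  = sym (ℤₚ.neg-involutive _)

!-∘D : ∀ {n} (π σ : Window n) m → (π ∘D σ) ! m ≡ apply π (σ ! m)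
!-∘D π σ = !-map (apply π) refl σ

apply-∘D : ∀ {n} (π σ : Window n) x → apply (π ∘D σ) x ≡ apply π (apply σ x)
apply-∘D π σ (+ zero)  = refl
apply-∘D π σ (+ suc m) = !-∘D π σ m
apply-∘D π σ -[1+ m ]  = trans (cong -_ (!-∘D π σ m)) (sym (apply-neg π (σ ! m)))

∘D-assoc : ∀ {n} (π σ ρ : Window n) → (π ∘D σ) ∘D ρ ≡ π ∘D (σ ∘D ρ)
∘D-assoc π σ ρ = !-ext _ _ λ m _ → begin
  ((π ∘D σ) ∘D ρ) ! m        ≡⟨ !-∘D (π ∘D σ) ρ m ⟩
  apply (π ∘D σ) (ρ ! m)     ≡⟨ apply-∘D π σ (ρ ! m) ⟩
  apply π (apply σ (ρ ! m))  ≡⟨ cong (apply π) (!-∘D σ ρ m) ⟨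
  apply π ((σ ∘D ρ) ! m)     ≡⟨ !-∘D π (σ ∘D ρ) m ⟨
  (π ∘D (σ ∘D ρ)) ! m        ∎
  where open ≡-Reasoning

!-idD : ∀ {n} m → m < n → idD n ! m ≡ + suc m
!-idD = !-tabulate (λ k → + suc k)

∘D-identityʳ : ∀ {n} (π : Window n) → π ∘D idD n ≡ π
∘D-identityʳ {n} π = !-ext _ _ λ m m<n → trans (!-∘D π (idD n) m) (cong (apply π) (!-idD m m<n))

-- apply (idD n) sends values outside {0, ±1, …, ±n} to 0, so idD n is a left identity only on such windows.
InRange : ∀ {n} → Window n → Set
InRange {n} τ = ∀ m → m < n → ∣ τ ! m ∣ ≤ n

apply-idD : ∀ {n} x → ∣ x ∣ ≤ n → apply (idD n) x ≡ x
apply-idD (+ zero)  _ = refl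
apply-idD (+ suc m) m<n = !-idD m m<n
apply-idD -[1+ m ]  m<n = cong -_ (!-idD m m<n)

∘D-identityˡ : ∀ {n} (τ : Window n) → InRange τ → idD n ∘D τ ≡ τ
∘D-identityˡ {n} τ r = !-ext _ _ λ m m<n → trans (!-∘D (idD n) τ m) (apply-idD (τ ! m) (r m m<n))

IsInvolution : ∀ {n} → Window n → Set
IsInvolution {n} τ = τ ∘D τ ≡ idD n

involution-move : ∀ {n} {τ σ π : Window n} → IsInvolution τ → σ ∘D τ ≡ π → σ ≡ π ∘D τ
involution-move {τ = τ} {σ} inv refl =
  sym (trans (∘D-assoc σ τ τ) (trans (cong (σ ∘D_) inv) (∘D-identityʳ σ)))

-- The group ring ℤ[𝒟ₙ]

term*ZD : ∀ {n} → ℤ × Window n → ZD n → ZD n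
term*ZD (a , π) = mapᴸ λ { (b , σ) → (a *ℤ b , π ∘D σ) }

*ZD-distribʳ-++ : ∀ {n} (x x′ y : ZD n) → (x ++ x′) *ZD y ≡ (x *ZD y) ++ (x′ *ZD y)
*ZD-distribʳ-++ []      x′ y = refl
*ZD-distribʳ-++ (t ∷ x) x′ y =
  trans (cong (term*ZD t y ++_) (*ZD-distribʳ-++ x x′ y)) (sym (Listₚ.++-assoc (term*ZD t y) _ _))

term*ZD-assoc : ∀ {n} (t : ℤ × Window n) (y z : ZD n) → term*ZD t y *ZD z ≡ term*ZD t (y *ZD z)
term*ZD-assoc t       []            z = refl
term*ZD-assoc (a , π) ((b , σ) ∷ y) z = begin
  term*ZD (a *ℤ b , π ∘D σ) z ++ (term*ZD (a , π) y *ZD z)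
    ≡⟨ cong₂ _++_ (merge z) (term*ZD-assoc (a , π) y z) ⟩
  term*ZD (a , π) (term*ZD (b , σ) z) ++ term*ZD (a , π) (y *ZD z)
    ≡⟨ Listₚ.map-++ _ (term*ZD (b , σ) z) (y *ZD z) ⟨
  term*ZD (a , π) (term*ZD (b , σ) z ++ (y *ZD z)) ∎
  where
  open ≡-Reasoning
  merge : ∀ z → term*ZD (a *ℤ b , π ∘D σ) z ≡ term*ZD (a , π) (term*ZD (b , σ) z)
  merge []            = refl
  merge ((c , ρ) ∷ z) = cong₂ _∷_ (cong₂ _,_ (ℤₚ.*-assoc a b c) (∘D-assoc π σ ρ)) (merge z)

*ZD-assoc : ∀ {n} (x y z : ZD n) → (x *ZD y) *ZD z ≡ x *ZD (y *ZD z)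
*ZD-assoc []      y z = refl
*ZD-assoc (t ∷ x) y z =
  trans (*ZD-distribʳ-++ (term*ZD t y) (x *ZD y) z) (cong₂ _++_ (term*ZD-assoc t y z) (*ZD-assoc x y z))

*ZD-identityʳ : ∀ {n} (x : ZD n) → x *ZD oneZD n ≡ x
*ZD-identityʳ []            = refl
*ZD-identityʳ ((a , π) ∷ x) =
  cong₂ _∷_ (cong₂ _,_ (ℤₚ.*-identityʳ a) (∘D-identityʳ π)) (*ZD-identityʳ x)

*ZD-identityˡ : ∀ {n} (x : ZD n) → All (InRange ∘ proj₂) x → oneZD n *ZD x ≡ x
*ZD-identityˡ {n} x r = trans (Listₚ.++-identityʳ _) (unit-term*ZD x r)
  where
  unit-term*ZD : ∀ x → All (InRange ∘ proj₂) x → term*ZD (+ 1 , idD n) x ≡ x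
  unit-term*ZD []            []       = refl
  unit-term*ZD ((a , π) ∷ x) (r ∷ rs) =
    cong₂ _∷_ (cong₂ _,_ (ℤₚ.*-identityˡ a) (∘D-identityˡ π r)) (unit-term*ZD x rs)

foldr-*ZD : ∀ {n} {A : Set} (g : A → ZD n) xs (z w : ZD n) →
  foldr (λ a acc → g a *ZD acc) (z *ZD w) xs ≡ foldr (λ a acc → g a *ZD acc) z xs *ZD w
foldr-*ZD g []       z w = refl
foldr-*ZD g (a ∷ xs) z w =
  trans (cong (g a *ZD_) (foldr-*ZD g xs z w)) (sym (*ZD-assoc (g a) _ w))

sumℤ : {A : Set} → (A → ℤ) → List A → ℤ
sumℤ g = foldr (λ x acc → g x +ℤ acc) (+ 0)

sumℤ-++ : ∀ {A : Set} (g : A → ℤ) xs ys → sumℤ g (xs ++ ys) ≡ sumℤ g xs +ℤ sumℤ g ys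
sumℤ-++ g []       ys = sym (ℤₚ.+-identityˡ _)
sumℤ-++ g (x ∷ xs) ys = trans (cong (g x +ℤ_) (sumℤ-++ g xs ys)) (sym (ℤₚ.+-assoc (g x) _ _))

sumℤ-map : ∀ {A B : Set} (g : B → ℤ) (k : A → B) xs → sumℤ g (mapᴸ k xs) ≡ sumℤ (g ∘ k) xs
sumℤ-map g k []       = refl
sumℤ-map g k (x ∷ xs) = cong (g (k x) +ℤ_) (sumℤ-map g k xs)

sumℤ-distrib-+ : ∀ {A : Set} (g k : A → ℤ) xs → sumℤ (λ x → g x +ℤ k x) xs ≡ sumℤ g xs +ℤ sumℤ k xs
sumℤ-distrib-+ g k []       = refl
sumℤ-distrib-+ g k (x ∷ xs) =
  trans (cong (g x +ℤ k x +ℤ_) (sumℤ-distrib-+ g k xs)) (+ℤ-interchange (g x) (k x) _ _)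

sumℤ-cong : ∀ {A : Set} {g k : A → ℤ} xs → All (λ x → g x ≡ k x) xs → sumℤ g xs ≡ sumℤ k xs
sumℤ-cong []       []       = refl
sumℤ-cong (x ∷ xs) (e ∷ es) = cong₂ _+ℤ_ e (sumℤ-cong xs es)

sumℤ-zero : ∀ {A : Set} {g : A → ℤ} xs → All (λ x → g x ≡ + 0) xs → sumℤ g xs ≡ + 0
sumℤ-zero []       []       = refl
sumℤ-zero (x ∷ xs) (e ∷ es) = cong₂ _+ℤ_ e (sumℤ-zero xs es)

coeff-++ : ∀ {n} (xs ys : ZD n) π → coeff (xs ++ ys) π ≡ coeff xs π +ℤ coeff ys π
coeff-++ []              ys π = sym (ℤₚ.+-identityˡ _)
coeff-++ ((a , σ) ∷ xs) ys π with Vecₚ.≡-dec ℤₚ._≟_ σ π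
... | yes _ = trans (cong (a +ℤ_) (coeff-++ xs ys π)) (sym (ℤₚ.+-assoc a _ _))
... | no _  = coeff-++ xs ys π

formalSum : ∀ {n} → List (Window n) → ZD n
formalSum = mapᴸ (+ 1 ,_)

coeff-term∘involution : ∀ {n} a (σ τ π : Window n) → IsInvolution τ →
  coeff [ (a *ℤ + 1 , σ ∘D τ) ] π ≡ coeff [ (a , σ) ] (π ∘D τ)
coeff-term∘involution a σ τ π inv
  with Vecₚ.≡-dec ℤₚ._≟_ (σ ∘D τ) π | Vecₚ.≡-dec ℤₚ._≟_ σ (π ∘D τ)
... | yes _  | yes _  = cong (_+ℤ + 0) (ℤₚ.*-identityʳ a)
... | yes eq | no ne  = ⊥-elim (ne (involution-move inv eq))
... | no ne  | yes eq = ⊥-elim (ne (sym (involution-move inv (sym eq))))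
... | no _   | no _   = refl

coeff-*ZD-formalSum : ∀ {n} (X : ZD n) (Ts : List (Window n)) → All IsInvolution Ts → ∀ π →
  coeff (X *ZD formalSum Ts) π ≡ sumℤ (λ τ → coeff X (π ∘D τ)) Ts
coeff-*ZD-formalSum []            Ts invs π = sym (sumℤ-zero Ts (All.tabulate (λ _ → refl)))
coeff-*ZD-formalSum ((a , σ) ∷ X) Ts invs π = begin
  coeff (term*ZD (a , σ) (formalSum Ts) ++ X *ZD formalSum Ts) π
    ≡⟨ coeff-++ (term*ZD (a , σ) (formalSum Ts)) _ π ⟩
  coeff (term*ZD (a , σ) (formalSum Ts)) π +ℤ coeff (X *ZD formalSum Ts) π
    ≡⟨ cong₂ _+ℤ_ (coeff-term*ZD Ts invs) (coeff-*ZD-formalSum X Ts invs π) ⟩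
  sumℤ (λ τ → coeff [ (a , σ) ] (π ∘D τ)) Ts +ℤ sumℤ (λ τ → coeff X (π ∘D τ)) Ts
    ≡⟨ sumℤ-distrib-+ (λ τ → coeff [ (a , σ) ] (π ∘D τ)) (λ τ → coeff X (π ∘D τ)) Ts ⟨
  sumℤ (λ τ → coeff [ (a , σ) ] (π ∘D τ) +ℤ coeff X (π ∘D τ)) Ts
    ≡⟨ sumℤ-cong Ts (All.tabulate λ {τ} _ → sym (coeff-++ [ (a , σ) ] X (π ∘D τ))) ⟩
  sumℤ (λ τ → coeff ((a , σ) ∷ X) (π ∘D τ)) Ts ∎
  where
  open ≡-Reasoning
  coeff-term*ZD : ∀ Ts → All IsInvolution Ts →
    coeff (term*ZD (a , σ) (formalSum Ts)) π ≡ sumℤ (λ τ → coeff [ (a , σ) ] (π ∘D τ)) Ts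
  coeff-term*ZD []       []         = refl
  coeff-term*ZD (τ ∷ Ts) (inv ∷ invs) =
    trans (coeff-++ [ (a *ℤ + 1 , σ ∘D τ) ] _ π)
          (cong₂ _+ℤ_ (coeff-term∘involution a σ τ π inv) (coeff-term*ZD Ts invs))

interval-cons : ∀ {a b} → a ≤ b → interval a b ≡ a ∷ interval (suc a) b
interval-cons a≤b rewrite ℕₚ.+-∸-assoc 1 a≤b = refl

interval-empty : ∀ {a b} → b < a → interval a b ≡ []
interval-empty b<a rewrite ℕₚ.m≤n⇒m∸n≡0 b<a = refl

interval-snoc : ∀ {a b} → a ≤ suc b → interval a (suc b) ≡ interval a b ++ [ suc b ]
interval-snoc {a} {b} a≤1+b = go (suc b ∸ a) a (sym (ℕₚ.m∸n+n≡m a≤1+b))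
  where
  go : ∀ d a → suc b ≡ d + a → interval a (suc b) ≡ interval a b ++ [ suc b ]
  go zero    a refl
    rewrite interval-cons (ℕₚ.≤-refl {suc b}) | interval-empty (ℕₚ.n<1+n (suc b))
          | interval-empty (ℕₚ.n<1+n b) = refl
  go (suc d) a eq = step (subst (a ≤_) (sym (ℕₚ.suc-injective eq)) (ℕₚ.m≤n+m a d))
    where
    step : a ≤ b → interval a (suc b) ≡ interval a b ++ [ suc b ]
    step a≤b rewrite interval-cons (ℕₚ.m≤n⇒m≤1+n a≤b) | interval-cons a≤b =
      cong (a ∷_) (go d (suc a) (trans eq (sym (ℕₚ.+-suc d a))))

All-interval : ∀ {P : ℕ → Set} a b → (∀ {i} → a ≤ i → i ≤ b → P i) → All P (interval a b)
All-interval zero    zero    p = p z≤n z≤n ∷ []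
All-interval (suc a) zero    p rewrite interval-empty (s≤s (z≤n {a})) = []
All-interval a       (suc b) p with a ≤? suc b
... | yes a≤1+b rewrite interval-snoc a≤1+b =
  Allₚ.++⁺ (All-interval a b λ a≤i i≤b → p a≤i (ℕₚ.m≤n⇒m≤1+n i≤b)) (p a≤1+b ℕₚ.≤-refl ∷ [])
... | no a≰1+b rewrite interval-empty (ℕₚ.≰⇒> a≰1+b) = []

sumℤ-interval-point : ∀ (g : ℕ → ℤ) a b i₀ → a ≤ i₀ → i₀ ≤ b → g i₀ ≡ + 1 →
  (∀ {i} → a ≤ i → i ≤ b → i ≢ i₀ → g i ≡ + 0) → sumℤ g (interval a b) ≡ + 1
sumℤ-interval-point g a zero    zero     a≤0 _ g1 g0 rewrite ℕₚ.n≤0⇒n≡0 a≤0 = cong (_+ℤ + 0) g1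
sumℤ-interval-point g a (suc b) i₀       a≤i₀ i₀≤1+b g1 g0
  rewrite interval-snoc (ℕₚ.≤-trans a≤i₀ i₀≤1+b) | sumℤ-++ g (interval a b) [ suc b ]
  with ℕₚ.m≤n⇒m<n∨m≡n i₀≤1+b
... | inj₁ (s≤s i₀≤b) =
  cong₂ _+ℤ_
    (sumℤ-interval-point g a b i₀ a≤i₀ i₀≤b g1 (λ a≤i i≤b → g0 a≤i (ℕₚ.m≤n⇒m≤1+n i≤b)))
    (cong (_+ℤ + 0) (g0 (ℕₚ.≤-trans a≤i₀ i₀≤1+b) ℕₚ.≤-refl (λ e → ℕₚ.<-irrefl (sym e) (s≤s i₀≤b))))
... | inj₂ refl =
  cong₂ _+ℤ_
    (sumℤ-zero (interval a b) (All-interval a b λ a≤i i≤b → g0 a≤i (ℕₚ.m≤n⇒m≤1+n i≤b) (ℕₚ.<⇒≢ (s≤s i≤b))))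
    (cong (_+ℤ + 0) g1)

-- Windows given by a signed position map

negIf : Bool → ℤ → ℤ
negIf false x = x
negIf true  x = - x

negIf-involutive : ∀ b x → negIf b (negIf b x) ≡ x
negIf-involutive false x = refl
negIf-involutive true  x = ℤₚ.neg-involutive x

∣negIf∣ : ∀ b x → ∣ negIf b x ∣ ≡ ∣ x ∣
∣negIf∣ false x = refl
∣negIf∣ true  x = ℤₚ.∣-i∣≡∣i∣ x

data Position (p q m : ℕ) : Set where
  at₁       : m ≡ p → Position p q m
  at₂       : m ≢ p → m ≡ q → Position p q m
  elsewhere : m ≢ p → m ≢ q → Position p q m

position : ∀ p q m → Position p q m
position p q m with m ≟ p | m ≟ q
... | yes m≡p | _       = at₁ m≡p
... | no m≢p  | yes m≡q = at₂ m≢p m≡q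
... | no m≢p  | no m≢q  = elsewhere m≢p m≢q

swapℕ : ℕ → ℕ → ℕ → ℕ
swapℕ p q m with m ≟ p | m ≟ q
... | yes _ | _     = q
... | no _  | yes _ = p
... | no _  | no _  = m

swapℕ-at₁ : ∀ p q → swapℕ p q p ≡ q
swapℕ-at₁ p q with p ≟ p
... | yes _  = refl
... | no p≢p = ⊥-elim (p≢p refl)

swapℕ-at₂ : ∀ p q → swapℕ p q q ≡ p
swapℕ-at₂ p q with q ≟ p | q ≟ q
... | yes refl | _      = refl
... | no _     | yes _  = refl
... | no _     | no q≢q = ⊥-elim (q≢q refl)

swapℕ-elsewhere : ∀ p q m → m ≢ p → m ≢ q → swapℕ p q m ≡ m
swapℕ-elsewhere p q m m≢p m≢q with m ≟ p | m ≟ q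
... | yes m≡p | _       = ⊥-elim (m≢p m≡p)
... | no _    | yes m≡q = ⊥-elim (m≢q m≡q)
... | no _    | no _    = refl

swapℕ-self : ∀ k m → swapℕ k k m ≡ m
swapℕ-self k m with position k k m
... | at₁ refl        = swapℕ-at₁ m m
... | at₂ m≢k m≡k     = ⊥-elim (m≢k m≡k)
... | elsewhere m≢k _ = swapℕ-elsewhere k k m m≢k m≢k

swapℕ-involutive : ∀ p q m → swapℕ p q (swapℕ p q m) ≡ m
swapℕ-involutive p q m with position p q m
... | at₁ refl rewrite swapℕ-at₁ m q = swapℕ-at₂ m q
... | at₂ _ refl rewrite swapℕ-at₂ p m = swapℕ-at₁ p m
... | elsewhere m≢p m≢q rewrite swapℕ-elsewhere p q m m≢p m≢q = swapℕ-elsewhere p q m m≢p m≢q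

swapℕ-< : ∀ {n} p q m → p < n → q < n → m < n → swapℕ p q m < n
swapℕ-< p q m p<n q<n m<n with position p q m
... | at₁ refl rewrite swapℕ-at₁ m q = q<n
... | at₂ _ refl rewrite swapℕ-at₂ p m = p<n
... | elsewhere m≢p m≢q rewrite swapℕ-elsewhere p q m m≢p m≢q = m<n

atEither : ℕ → ℕ → ℕ → Bool
atEither p q m = ⌊ m ≟ p ⌋ ∨ ⌊ m ≟ q ⌋

atEither-at₁ : ∀ p q → atEither p q p ≡ true
atEither-at₁ p q with p ≟ p
... | yes _  = refl
... | no p≢p = ⊥-elim (p≢p refl)

atEither-at₂ : ∀ p q → atEither p q q ≡ true
atEither-at₂ p q with q ≟ p | q ≟ q
... | yes _ | _      = refl
... | no _  | yes _  = refl
... | no _  | no q≢q = ⊥-elim (q≢q refl)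

atEither-elsewhere : ∀ p q m → m ≢ p → m ≢ q → atEither p q m ≡ false
atEither-elsewhere p q m m≢p m≢q with m ≟ p | m ≟ q
... | yes m≡p | _       = ⊥-elim (m≢p m≡p)
... | no _    | yes m≡q = ⊥-elim (m≢q m≡q)
... | no _    | no _    = refl

atEither-swapℕ : ∀ p q m → atEither p q (swapℕ p q m) ≡ atEither p q m
atEither-swapℕ p q m with position p q m
... | at₁ refl rewrite swapℕ-at₁ m q | atEither-at₁ m q = atEither-at₂ m q
... | at₂ _ refl rewrite swapℕ-at₂ p m | atEither-at₂ p m = atEither-at₁ p m
... | elsewhere m≢p m≢q rewrite swapℕ-elsewhere p q m m≢p m≢q = refl

-- In 1-based terms τ(m+1) = ±(s m + 1): s and e act on 0-based positions.
record IsSignedPermOf n (s : ℕ → ℕ) (e : ℕ → Bool) (τ : Window n) : Set where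
  constructor signedPermOf
  field !-signedPermOf : ∀ m → m < n → τ ! m ≡ negIf (e m) (+ suc (s m))

open IsSignedPermOf

signedPermOf-cong : ∀ {n s s′ e} {τ : Window n} → (∀ m → s m ≡ s′ m) →
  IsSignedPermOf n s e τ → IsSignedPermOf n s′ e τ
signedPermOf-cong {e = e} s≗s′ τ≅ =
  signedPermOf λ m m<n → trans (!-signedPermOf τ≅ m m<n) (cong (λ x → negIf (e m) (+ suc x)) (s≗s′ m))

apply-negIf : ∀ {n} (π : Window n) b k → apply π (negIf b (+ suc k)) ≡ negIf b (π ! k)
apply-negIf π false k = refl
apply-negIf π true  k = refl

!-∘D-signedPermOf : ∀ {n s e} {τ : Window n} → IsSignedPermOf n s e τ →
  ∀ (π : Window n) m → m < n → (π ∘D τ) ! m ≡ negIf (e m) (π ! s m)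
!-∘D-signedPermOf {s = s} {e} {τ} τ≅ π m m<n =
  trans (!-∘D π τ m) (trans (cong (apply π) (!-signedPermOf τ≅ m m<n)) (apply-negIf π (e m) (s m)))

signedPermOf-involution : ∀ {n s e} {τ : Window n} → IsSignedPermOf n s e τ →
  (∀ m → m < n → s m < n) → (∀ m → s (s m) ≡ m) → (∀ m → e (s m) ≡ e m) → IsInvolution τ
signedPermOf-involution {n} {s} {e} {τ} τ≅ s<n s-inv e∘s = !-ext _ _ λ m m<n → begin
  (τ ∘D τ) ! m                             ≡⟨ !-∘D-signedPermOf τ≅ τ m m<n ⟩
  negIf (e m) (τ ! s m)                    ≡⟨ cong (negIf (e m)) (!-signedPermOf τ≅ (s m) (s<n m m<n)) ⟩
  negIf (e m) (negIf (e (s m)) (+ suc (s (s m))))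
    ≡⟨ cong₂ (λ b k → negIf (e m) (negIf b (+ suc k))) (e∘s m) (s-inv m) ⟩
  negIf (e m) (negIf (e m) (+ suc m))      ≡⟨ negIf-involutive (e m) _ ⟩
  + suc m                                  ≡⟨ !-idD m m<n ⟨
  idD n ! m                                ∎
  where open ≡-Reasoning

signedPermOf-inRange : ∀ {n s e} {τ : Window n} → IsSignedPermOf n s e τ →
  (∀ m → m < n → s m < n) → InRange τ
signedPermOf-inRange {s = s} {e} τ≅ s<n m m<n rewrite !-signedPermOf τ≅ m m<n =
  subst (_≤ _) (sym (∣negIf∣ (e m) (+ suc (s m)))) (s<n m m<n)

swapVal-≡a : ∀ a b x → x ≡ a → swapVal a b x ≡ b
swapVal-≡a a b x x≡a with x ℤₚ.≟ a
... | yes _  = refl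
... | no x≢a = ⊥-elim (x≢a x≡a)

swapVal-≡b : ∀ a b x → x ≢ a → x ≡ b → swapVal a b x ≡ a
swapVal-≡b a b x x≢a x≡b with x ℤₚ.≟ a | x ℤₚ.≟ b
... | yes x≡a | _      = ⊥-elim (x≢a x≡a)
... | no _    | yes _  = refl
... | no _    | no x≢b = ⊥-elim (x≢b x≡b)

swapVal-≡-a : ∀ a b x → x ≢ a → x ≢ b → x ≡ - a → swapVal a b x ≡ - b
swapVal-≡-a a b x x≢a x≢b x≡-a with x ℤₚ.≟ a | x ℤₚ.≟ b | x ℤₚ.≟ - a
... | yes x≡a | _       | _       = ⊥-elim (x≢a x≡a)
... | no _    | yes x≡b | _       = ⊥-elim (x≢b x≡b)
... | no _    | no _    | yes _   = refl
... | no _    | no _    | no x≢-a = ⊥-elim (x≢-a x≡-a)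

swapVal-fixed : ∀ a b x → x ≢ a → x ≢ b → x ≢ - a → x ≢ - b → swapVal a b x ≡ x
swapVal-fixed a b x x≢a x≢b x≢-a x≢-b with x ℤₚ.≟ a | x ℤₚ.≟ b | x ℤₚ.≟ - a | x ℤₚ.≟ - b
... | yes x≡a | _       | _        | _        = ⊥-elim (x≢a x≡a)
... | no _    | yes x≡b | _        | _        = ⊥-elim (x≢b x≡b)
... | no _    | no _    | yes x≡-a | _        = ⊥-elim (x≢-a x≡-a)
... | no _    | no _    | no _     | yes x≡-b = ⊥-elim (x≢-b x≡-b)
... | no _    | no _    | no _     | no _     = refl

+suc≢-+suc : ∀ m k → + suc m ≢ - (+ suc k)
+suc≢-+suc m k ()

+suc-injective : ∀ {m k} → + suc m ≡ + suc k → m ≡ k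
+suc-injective refl = refl

∣∣≡suc⇒± : ∀ x {m} → ∣ x ∣ ≡ suc m → x ≡ + suc m ⊎ x ≡ -[1+ m ]
∣∣≡suc⇒± (+ suc m) refl = inj₁ refl
∣∣≡suc⇒± -[1+ m ]  refl = inj₂ refl

-[1+]≢+ : ∀ {x m} → x ≡ -[1+ m ] → x ≢ + suc m
-[1+]≢+ refl ()

-≢+ : ∀ {x m} → x ≡ + suc m → - x ≢ + suc m
-≢+ refl ()

idD-signedPermOf : ∀ n → IsSignedPermOf n id (λ _ → false) (idD n)
idD-signedPermOf n = signedPermOf !-idD

tD-signedPermOf : ∀ n i j → IsSignedPermOf n (swapℕ i j) (λ _ → false) (tD n (suc i) (suc j))
tD-signedPermOf n i j = signedPermOf λ m m<n →
  trans (!-tabulate (λ k → swapVal (+ suc i) (+ suc j) (+ suc k)) m m<n) (value m)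
  where
  value : ∀ m → swapVal (+ suc i) (+ suc j) (+ suc m) ≡ + suc (swapℕ i j m)
  value m with position i j m
  ... | at₁ refl rewrite swapℕ-at₁ m j = swapVal-≡a (+ suc m) (+ suc j) (+ suc m) refl
  ... | at₂ m≢i refl rewrite swapℕ-at₂ i m =
    swapVal-≡b (+ suc i) (+ suc m) (+ suc m) (m≢i ∘ +suc-injective) refl
  ... | elsewhere m≢i m≢j rewrite swapℕ-elsewhere i j m m≢i m≢j =
    swapVal-fixed (+ suc i) (+ suc j) (+ suc m)
      (m≢i ∘ +suc-injective) (m≢j ∘ +suc-injective) (+suc≢-+suc m i) (+suc≢-+suc m j)

tDbar-signedPermOf : ∀ n i j → i ≢ j → IsSignedPermOf n (swapℕ i j) (atEither i j) (tDbar n (suc i) (suc j))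
tDbar-signedPermOf n i j i≢j with suc i ≟ suc j
... | yes 1+i≡1+j = ⊥-elim (i≢j (ℕₚ.suc-injective 1+i≡1+j))
... | no _ = signedPermOf λ m m<n →
  trans (!-tabulate (λ k → swapVal (- (+ suc i)) (+ suc j) (+ suc k)) m m<n) (value m)
  where
  value : ∀ m → swapVal (- (+ suc i)) (+ suc j) (+ suc m) ≡ negIf (atEither i j m) (+ suc (swapℕ i j m))
  value m with position i j m
  ... | at₁ refl rewrite swapℕ-at₁ m j | atEither-at₁ m j =
    swapVal-≡-a (- (+ suc m)) (+ suc j) (+ suc m) (λ ()) (i≢j ∘ +suc-injective) refl
  ... | at₂ m≢i refl rewrite swapℕ-at₂ i m | atEither-at₂ i m =
    swapVal-≡b (- (+ suc i)) (+ suc m) (+ suc m) (λ ()) refl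
  ... | elsewhere m≢i m≢j rewrite swapℕ-elsewhere i j m m≢i m≢j | atEither-elsewhere i j m m≢i m≢j =
    swapVal-fixed (- (+ suc i)) (+ suc j) (+ suc m) (λ ()) (m≢j ∘ +suc-injective) (m≢i ∘ +suc-injective) (λ ())

tDbar-diag-signedPermOf : ∀ n k → IsSignedPermOf n id (atEither 0 k) (tDbar n (suc k) (suc k))
tDbar-diag-signedPermOf n k with suc k ≟ suc k
... | no 1+k≢1+k = ⊥-elim (1+k≢1+k refl)
... | yes _ = signedPermOf λ m m<n → trans (!-tabulate _ m m<n) (value m)
  where
  value : ∀ m → (if ⌊ suc m ≟ 1 ⌋ then - (+ suc m) else if ⌊ suc m ≟ suc k ⌋ then - (+ suc m) else + suc m)
                ≡ negIf (atEither 0 k m) (+ suc m)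
  value m with position 0 k m
  ... | at₁ refl = refl
  ... | at₂ m≢0 refl rewrite atEither-at₂ 0 m with suc m ≟ 1 | suc m ≟ suc m
  ...   | yes 1+m≡1 | _           = ⊥-elim (m≢0 (ℕₚ.suc-injective 1+m≡1))
  ...   | no _      | yes _       = refl
  ...   | no _      | no 1+m≢1+m  = ⊥-elim (1+m≢1+m refl)
  value m | elsewhere m≢0 m≢k rewrite atEither-elsewhere 0 k m m≢0 m≢k with suc m ≟ 1 | suc m ≟ suc k
  ...   | yes 1+m≡1   | _           = ⊥-elim (m≢0 (ℕₚ.suc-injective 1+m≡1))
  ...   | no _        | yes 1+m≡1+k = ⊥-elim (m≢k (ℕₚ.suc-injective 1+m≡1+k))
  ...   | no _        | no _        = refl

-- Parity of the number of negative entries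

sumBelow : ℕ → (ℕ → ℕ) → ℕ
sumBelow zero    A = 0
sumBelow (suc n) A = A 0 + sumBelow n (A ∘ suc)

sumBelow-cong : ∀ n {A B : ℕ → ℕ} → (∀ m → m < n → A m ≡ B m) → sumBelow n A ≡ sumBelow n B
sumBelow-cong zero    eq = refl
sumBelow-cong (suc n) eq = cong₂ _+_ (eq 0 (s≤s z≤n)) (sumBelow-cong n λ m m<n → eq (suc m) (s≤s m<n))

sumBelow-zero : ∀ n → sumBelow n (λ _ → 0) ≡ 0
sumBelow-zero zero    = refl
sumBelow-zero (suc n) = sumBelow-zero n

sumBelow-head : ∀ n {A : ℕ → ℕ} → 0 < n → (∀ {m} → 1 ≤ m → m < n → A m ≡ 0) → sumBelow n A ≡ A 0
sumBelow-head (suc n) {A} _ zero-above =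
  trans (cong (_+_ (A 0)) (trans (sumBelow-cong n λ m m<n → zero-above (s≤s z≤n) (s≤s m<n)) (sumBelow-zero n)))
        (ℕₚ.+-identityʳ (A 0))

sumBelow-update : ∀ n (A B : ℕ → ℕ) p → p < n → (∀ m → m < n → m ≢ p → B m ≡ A m) →
  sumBelow n B + A p ≡ sumBelow n A + B p
sumBelow-update (suc n) A B zero    _         eq
  rewrite sumBelow-cong n {B ∘ suc} {A ∘ suc} (λ m m<n → eq (suc m) (s≤s m<n) λ ()) =
  xy∙z≈zy∙x (B 0) (sumBelow n (A ∘ suc)) (A 0)
sumBelow-update (suc n) A B (suc p) (s≤s p<n) eq rewrite eq 0 (s≤s z≤n) λ () =
  trans (ℕₚ.+-assoc (A 0) _ (A (suc p)))
        (trans (cong (_+_ (A 0)) (sumBelow-update n (A ∘ suc) (B ∘ suc) p p<n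
                  λ m m<n m≢p → eq (suc m) (s≤s m<n) (m≢p ∘ ℕₚ.suc-injective)))
               (sym (ℕₚ.+-assoc (A 0) _ (B (suc p)))))

sumBelow-update₂ : ∀ n (A B : ℕ → ℕ) p q → p < n → q < n → p ≢ q →
  (∀ m → m < n → m ≢ p → m ≢ q → B m ≡ A m) →
  sumBelow n B + (A p + A q) ≡ sumBelow n A + (B p + B q)
sumBelow-update₂ n A B p q p<n q<n p≢q eq = begin
  sumBelow n B + (A p + A q)   ≡⟨ x∙yz≈xz∙y (sumBelow n B) (A p) (A q) ⟩
  sumBelow n B + A q + A p     ≡⟨ cong (_+ A p) second ⟩
  sumBelow n C + B q + A p     ≡⟨ xy∙z≈xz∙y (sumBelow n C) (B q) (A p) ⟩
  sumBelow n C + A p + B q     ≡⟨ cong (_+ B q) first ⟩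
  sumBelow n A + B p + B q     ≡⟨ ℕₚ.+-assoc (sumBelow n A) (B p) (B q) ⟩
  sumBelow n A + (B p + B q)   ∎
  where
  open ≡-Reasoning
  C : ℕ → ℕ
  C m with m ≟ p
  ... | yes _ = B p
  ... | no _  = A m
  C-at-p : C p ≡ B p
  C-at-p with p ≟ p
  ... | yes _  = refl
  ... | no p≢p = ⊥-elim (p≢p refl)
  C-off-p : ∀ m → m ≢ p → C m ≡ A m
  C-off-p m m≢p with m ≟ p
  ... | yes m≡p = ⊥-elim (m≢p m≡p)
  ... | no _    = refl
  first : sumBelow n C + A p ≡ sumBelow n A + B p
  first = trans (sumBelow-update n A C p p<n (λ m _ → C-off-p m)) (cong (_+_ (sumBelow n A)) C-at-p)
  B≡C-off-q : ∀ m → m < n → m ≢ q → B m ≡ C m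
  B≡C-off-q m m<n m≢q with m ≟ p
  ... | yes refl = refl
  ... | no m≢p   = eq m m<n m≢p m≢q
  second : sumBelow n B + A q ≡ sumBelow n C + B q
  second = trans (cong (_+_ (sumBelow n B)) (sym (C-off-p q (p≢q ∘ sym))))
                 (sumBelow-update n C B q q<n B≡C-off-q)

sumBelow-swapℕ : ∀ n (A : ℕ → ℕ) p q → p < n → q < n → p ≢ q →
  sumBelow n (A ∘ swapℕ p q) ≡ sumBelow n A
sumBelow-swapℕ n A p q p<n q<n p≢q = ℕₚ.+-cancelʳ-≡ _ _ _ (begin
  sumBelow n (A ∘ swapℕ p q) + (A p + A q)
    ≡⟨ sumBelow-update₂ n A (A ∘ swapℕ p q) p q p<n q<n p≢q
         (λ m _ m≢p m≢q → cong A (swapℕ-elsewhere p q m m≢p m≢q)) ⟩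
  sumBelow n A + (A (swapℕ p q p) + A (swapℕ p q q))
    ≡⟨ cong₂ (λ x y → sumBelow n A + (A x + A y)) (swapℕ-at₁ p q) (swapℕ-at₂ p q) ⟩
  sumBelow n A + (A q + A p)
    ≡⟨ cong (_+_ (sumBelow n A)) (ℕₚ.+-comm (A q) (A p)) ⟩
  sumBelow n A + (A p + A q) ∎)
  where open ≡-Reasoning

negIndicator : ℤ → ℕ
negIndicator x = if isNeg x then 1 else 0

negCount≡sumBelow : ∀ {n} (π : Window n) → negCount π ≡ sumBelow n (negIndicator ∘ (π !_))
negCount≡sumBelow []      = refl
negCount≡sumBelow (x ∷ π) = cong (_+_ (negIndicator x)) (negCount≡sumBelow π)

negIndicator-+neg : ∀ x → 1 ≤ ∣ x ∣ → negIndicator x + negIndicator (- x) ≡ 1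
negIndicator-+neg (+ suc k) _ = refl
negIndicator-+neg -[1+ k ]  _ = refl

-- S′ − S = c′ − c = 2 − 2c.
even-preserved : ∀ {S S′ c c′} → S′ + c ≡ S + c′ → c + c′ ≡ 2 → 2 ∣ S → 2 ∣ S′
even-preserved {S} {S′} {c} {c′} eq c+c′≡2 2∣S =
  ∣m+n∣m⇒∣n (subst (2 ∣_) S+2≡ (∣m∣n⇒∣m+n 2∣S ∣-refl)) (divides c 2c≡c*2)
  where
  open ≡-Reasoning
  2c≡c*2 : c + c ≡ c * 2
  2c≡c*2 = trans (cong (_+_ c) (sym (ℕₚ.+-identityʳ c))) (ℕₚ.*-comm 2 c)
  S+2≡ : S + 2 ≡ (c + c) + S′
  S+2≡ = begin
    S + 2              ≡⟨ cong (_+_ S) (trans (sym c+c′≡2) (ℕₚ.+-comm c c′)) ⟩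
    S + (c′ + c)       ≡⟨ ℕₚ.+-assoc S c′ c ⟨
    S + c′ + c         ≡⟨ cong (_+ c) eq ⟨
    S′ + c + c         ≡⟨ ℕₚ.+-assoc S′ c c ⟩
    S′ + (c + c)       ≡⟨ ℕₚ.+-comm S′ (c + c) ⟩
    (c + c) + S′       ∎

record SignedPermOn (n : ℕ) (F : ℕ → ℤ) : Set where
  field
    nonzero      : ∀ {m} → m < n → 1 ≤ ∣ F m ∣
    bounded      : ∀ {m} → m < n → ∣ F m ∣ ≤ n
    ∣∣-injective : ∀ {m m′} → m < n → m′ < n → ∣ F m ∣ ≡ ∣ F m′ ∣ → m ≡ m′

record EvenSignedPermOn (n : ℕ) (F : ℕ → ℤ) : Set where
  field
    signedPerm : SignedPermOn n F
    evenNeg    : 2 ∣ sumBelow n (negIndicator ∘ F)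

open SignedPermOn
open EvenSignedPermOn using (signedPerm; evenNeg)

InD⇒evenSignedPermOn : ∀ {n} (π : Window n) → InD π → EvenSignedPermOn n (π !_)
InD⇒evenSignedPermOn {n} π ((range , inj) , even) = record
  { signedPerm = record
    { nonzero      = λ m<n → subst (λ x → 1 ≤ ∣ x ∣) (at m<n) (proj₁ (range (fromℕ< m<n)))
    ; bounded      = λ m<n → subst (λ x → ∣ x ∣ ≤ n) (at m<n) (proj₂ (range (fromℕ< m<n)))
    ; ∣∣-injective = λ m<n m′<n eq →
        trans (sym (Finₚ.toℕ-fromℕ< m<n))
              (trans (cong toℕ (inj _ _ (trans (cong ∣_∣ (at m<n)) (trans eq (cong ∣_∣ (sym (at m′<n)))))))
                     (Finₚ.toℕ-fromℕ< m′<n))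
    }
  ; evenNeg = subst (2 ∣_) (negCount≡sumBelow π) even
  }
  where
  at : ∀ {m} (m<n : m < n) → lookup π (fromℕ< m<n) ≡ π ! m
  at m<n = trans (lookup≡! π _) (cong (π !_) (Finₚ.toℕ-fromℕ< m<n))

evenSignedPermOn⇒InD : ∀ {n} (π : Window n) → EvenSignedPermOn n (π !_) → InD π
evenSignedPermOn⇒InD {n} π σ =
  ( (λ i → subst (λ x → 1 ≤ ∣ x ∣ × ∣ x ∣ ≤ n) (sym (lookup≡! π i))
             (nonzero (signedPerm σ) (Finₚ.toℕ<n i) , bounded (signedPerm σ) (Finₚ.toℕ<n i)))
  , λ i j eq → Finₚ.toℕ-injective (∣∣-injective (signedPerm σ) (Finₚ.toℕ<n i) (Finₚ.toℕ<n j)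
                 (trans (cong ∣_∣ (sym (lookup≡! π i))) (trans eq (cong ∣_∣ (lookup≡! π j))))))
  , subst (2 ∣_) (sym (negCount≡sumBelow π)) (evenNeg σ)

evenSignedPermOn-cong : ∀ {n F G} → (∀ m → m < n → G m ≡ F m) → EvenSignedPermOn n F → EvenSignedPermOn n G
evenSignedPermOn-cong {n} eq σ = record
  { signedPerm = record
    { nonzero      = λ {m} m<n → subst (λ x → 1 ≤ ∣ x ∣) (sym (eq m m<n)) (nonzero (signedPerm σ) m<n)
    ; bounded      = λ {m} m<n → subst (λ x → ∣ x ∣ ≤ n) (sym (eq m m<n)) (bounded (signedPerm σ) m<n)
    ; ∣∣-injective = λ {m} {m′} m<n m′<n e → ∣∣-injective (signedPerm σ) m<n m′<n
        (trans (cong ∣_∣ (sym (eq m m<n))) (trans e (cong ∣_∣ (eq m′ m′<n))))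
    }
  ; evenNeg = subst (2 ∣_) (sumBelow-cong n λ m m<n → cong negIndicator (sym (eq m m<n))) (evenNeg σ)
  }

signedPermOn-reindex : ∀ {n F} (s : ℕ → ℕ) (e : ℕ → Bool) → (∀ {m} → m < n → s m < n) →
  (∀ m → s (s m) ≡ m) → SignedPermOn n F → SignedPermOn n (λ m → negIf (e m) (F (s m)))
signedPermOn-reindex {n} {F} s e s<n s-inv σ = record
  { nonzero      = λ {m} m<n → subst (1 ≤_) (sym (∣negIf∣ (e m) _)) (nonzero σ (s<n m<n))
  ; bounded      = λ {m} m<n → subst (_≤ n) (sym (∣negIf∣ (e m) _)) (bounded σ (s<n m<n))
  ; ∣∣-injective = λ {m} {m′} m<n m′<n eq →
      trans (sym (s-inv m)) (trans (cong s (∣∣-injective σ (s<n m<n) (s<n m′<n)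
        (trans (sym (∣negIf∣ (e m) _)) (trans eq (∣negIf∣ (e m′) _))))) (s-inv m′))
  }

evenSignedPermOn-swap : ∀ {n F} p q → p < n → q < n → p ≢ q →
  EvenSignedPermOn n F → EvenSignedPermOn n (F ∘ swapℕ p q)
evenSignedPermOn-swap {n} {F} p q p<n q<n p≢q σ = record
  { signedPerm = signedPermOn-reindex (swapℕ p q) (λ _ → false) (swapℕ-< p q _ p<n q<n)
                   (swapℕ-involutive p q) (signedPerm σ)
  ; evenNeg    = subst (2 ∣_) (sym (sumBelow-swapℕ n (negIndicator ∘ F) p q p<n q<n p≢q)) (evenNeg σ)
  }

evenSignedPermOn-negate₂ : ∀ {n F} p q → p < n → q < n → p ≢ q →
  EvenSignedPermOn n F → EvenSignedPermOn n (λ m → negIf (atEither p q m) (F m))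
evenSignedPermOn-negate₂ {n} {F} p q p<n q<n p≢q σ = record
  { signedPerm = signedPermOn-reindex id (atEither p q) id (λ _ → refl) (signedPerm σ)
  ; evenNeg    = even-preserved (sumBelow-update₂ n (negIndicator ∘ F) (negIndicator ∘ G) p q p<n q<n p≢q
                   λ m _ m≢p m≢q → cong (λ b → negIndicator (negIf b (F m))) (atEither-elsewhere p q m m≢p m≢q))
                   (trans (cong₂ (λ x y → ν (F p) + ν (F q) + (ν x + ν y)) Gp Gq) flips) (evenNeg σ)
  }
  where
  ν = negIndicator
  G = λ m → negIf (atEither p q m) (F m)
  Gp : G p ≡ - F p
  Gp = cong (λ b → negIf b (F p)) (atEither-at₁ p q)
  Gq : G q ≡ - F q
  Gq = cong (λ b → negIf b (F q)) (atEither-at₂ p q)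
  flips : ν (F p) + ν (F q) + (ν (- F p) + ν (- F q)) ≡ 2
  flips = trans (+-interchange (ν (F p)) (ν (F q)) (ν (- F p)) (ν (- F q)))
                (cong₂ _+_ (negIndicator-+neg (F p) (nonzero (signedPerm σ) p<n))
                           (negIndicator-+neg (F q) (nonzero (signedPerm σ) q<n)))

signedPermOn-¬allBelow : ∀ {n F k} → SignedPermOn n F → k < n → ¬ (∀ {x} → x ≤ k → ∣ F x ∣ ≤ k)
signedPermOn-¬allBelow {n} {F} {k} σ k<n small
  with Finₚ.pigeonhole (ℕₚ.n<1+n k) (λ i → fromℕ< (value<k (ℕₚ.≤-pred (Finₚ.toℕ<n i))))
  where
  value<k : ∀ {x} → x ≤ k → ∣ F x ∣ ∸ 1 < k
  value<k x≤k = ℕₚ.∸-monoˡ-< (s≤s (small x≤k)) (nonzero σ (ℕₚ.≤-<-trans x≤k k<n))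
... | i , j , i<j , gi≡gj = ℕₚ.<-irrefl
  (∣∣-injective σ i<n j<n (ℕₚ.∸-cancelʳ-≡ (nonzero σ i<n) (nonzero σ j<n)
    (trans (sym (Finₚ.toℕ-fromℕ< _)) (trans (cong toℕ gi≡gj) (Finₚ.toℕ-fromℕ< _)))))
  i<j
  where
  i<n = ℕₚ.≤-<-trans (ℕₚ.≤-pred (Finₚ.toℕ<n i)) k<n
  j<n = ℕₚ.≤-<-trans (ℕₚ.≤-pred (Finₚ.toℕ<n j)) k<n

-- The terms of Θ_{k+1}

-- τ exchanges positions p ≤ k and k (0-based) up to the signs, which are ε at k.
record Term (n k p : ℕ) (ε : Bool) (τ : Window n) : Set where
  field
    signs      : ℕ → Bool
    shape      : IsSignedPermOf n (swapℕ p k) signs τ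
    p≤k        : p ≤ k
    sign-at-k  : signs k ≡ ε
    sign-above : ∀ {m} → k < m → signs m ≡ false
    signs-swap : ∀ m → signs (swapℕ p k m) ≡ signs m
    preserves  : ∀ {F} → EvenSignedPermOn n F → EvenSignedPermOn n (λ m → negIf (signs m) (F (swapℕ p k m)))

module TermProperties {n k p ε τ} (t : Term n k p ε τ) (k<n : k < n) where
  open Term t public

  p<n : p < n
  p<n = ℕₚ.≤-<-trans p≤k k<n

  swap<n : ∀ {m} → m < n → swapℕ p k m < n
  swap<n = swapℕ-< p k _ p<n k<n

  involution : IsInvolution τ
  involution = signedPermOf-involution shape (λ _ → swap<n) (swapℕ-involutive p k) signs-swap

  inRange : InRange τ
  inRange = signedPermOf-inRange shape λ _ → swap<n

  !-∘ : ∀ (π : Window n) {m} → m < n → (π ∘D τ) ! m ≡ negIf (signs m) (π ! swapℕ p k m)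
  !-∘ π m<n = !-∘D-signedPermOf shape π _ m<n

  ∣!-∘∣ : ∀ (π : Window n) {m} → m < n → ∣ (π ∘D τ) ! m ∣ ≡ ∣ π ! swapℕ p k m ∣
  ∣!-∘∣ π m<n = trans (cong ∣_∣ (!-∘ π m<n)) (∣negIf∣ (signs _) _)

  !-∘-at-k : ∀ (π : Window n) → (π ∘D τ) ! k ≡ negIf ε (π ! p)
  !-∘-at-k π = trans (!-∘ π k<n) (cong₂ (λ b q → negIf b (π ! q)) sign-at-k (swapℕ-at₂ p k))

  !-∘-above : ∀ (π : Window n) {m} → k < m → m < n → (π ∘D τ) ! m ≡ π ! m
  !-∘-above π {m} k<m m<n = trans (!-∘ π m<n) (cong₂ (λ b q → negIf b (π ! q)) (sign-above k<m)
    (swapℕ-elsewhere p k m (λ m≡p → ℕₚ.<-irrefl (sym m≡p) (ℕₚ.≤-<-trans p≤k k<m)) (ℕₚ.>⇒≢ k<m)))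

  evenSignedPermOn-∘ : ∀ {π : Window n} → EvenSignedPermOn n (π !_) → EvenSignedPermOn n ((π ∘D τ) !_)
  evenSignedPermOn-∘ σ = evenSignedPermOn-cong (λ m m<n → !-∘ _ m<n) (preserves σ)

idD-term : ∀ n k → Term n k k false (idD n)
idD-term n k = record
  { signs      = λ _ → false
  ; shape      = signedPermOf-cong (λ m → sym (swapℕ-self k m)) (idD-signedPermOf n)
  ; p≤k        = ℕₚ.≤-refl
  ; sign-at-k  = refl
  ; sign-above = λ _ → refl
  ; signs-swap = λ _ → refl
  ; preserves  = λ {F} → evenSignedPermOn-cong (λ m _ → cong F (swapℕ-self k m))
  }

tD-term : ∀ {n i k} → i < k → k < n → Term n k i false (tD n (suc i) (suc k))
tD-term {n} {i} {k} i<k k<n = record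
  { signs      = λ _ → false
  ; shape      = tD-signedPermOf n i k
  ; p≤k        = ℕₚ.<⇒≤ i<k
  ; sign-at-k  = refl
  ; sign-above = λ _ → refl
  ; signs-swap = λ _ → refl
  ; preserves  = evenSignedPermOn-swap i k (ℕₚ.<-trans i<k k<n) k<n (ℕₚ.<⇒≢ i<k)
  }

tDbar-term : ∀ {n i k} → i < k → k < n → Term n k i true (tDbar n (suc i) (suc k))
tDbar-term {n} {i} {k} i<k k<n = record
  { signs      = atEither i k
  ; shape      = tDbar-signedPermOf n i k (ℕₚ.<⇒≢ i<k)
  ; p≤k        = ℕₚ.<⇒≤ i<k
  ; sign-at-k  = atEither-at₂ i k
  ; sign-above = λ {m} k<m →
      atEither-elsewhere i k m (ℕₚ.>⇒≢ (ℕₚ.<-trans i<k k<m)) (ℕₚ.>⇒≢ k<m)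
  ; signs-swap = atEither-swapℕ i k
  ; preserves  = evenSignedPermOn-negate₂ i k i<n k<n (ℕₚ.<⇒≢ i<k)
               ∘ evenSignedPermOn-swap i k i<n k<n (ℕₚ.<⇒≢ i<k)
  }
  where i<n = ℕₚ.<-trans i<k k<n

tDbar-diag-term : ∀ {n k} → 0 < k → k < n → Term n k k true (tDbar n (suc k) (suc k))
tDbar-diag-term {n} {k} 0<k k<n = record
  { signs      = atEither 0 k
  ; shape      = signedPermOf-cong (λ m → sym (swapℕ-self k m)) (tDbar-diag-signedPermOf n k)
  ; p≤k        = ℕₚ.≤-refl
  ; sign-at-k  = atEither-at₂ 0 k
  ; sign-above = λ {m} k<m →
      atEither-elsewhere 0 k m (ℕₚ.>⇒≢ (ℕₚ.<-trans 0<k k<m)) (ℕₚ.>⇒≢ k<m)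
  ; signs-swap = λ m → cong (atEither 0 k) (swapℕ-self k m)
  ; preserves  = λ {F} σ →
      evenSignedPermOn-cong (λ m _ → cong (λ x → negIf (atEither 0 k m) (F x)) (swapℕ-self k m))
        (evenSignedPermOn-negate₂ 0 k (ℕₚ.<-trans 0<k k<n) k<n (ℕₚ.<⇒≢ 0<k) σ)
  }

module Expansion
  (n : ℕ) (f : Vec ℕ n)
  (f-mono : ∀ (i j : Fin n) → i Data.Fin.≤ j → lookup f i ≤ lookup f j)
  (nonempty : ∃ (InDf f))
  (h : ℕ → ℕ) (isH : IsH n f h)
  where

  f!-mono : ∀ {m m′} → m ≤ m′ → m′ < n → f !ℕ m ≤ f !ℕ m′
  f!-mono {m} {m′} m≤m′ m′<n =
    subst₂ _≤_ (at m<n) (at m′<n) (f-mono (fromℕ< m<n) (fromℕ< m′<n)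
      (subst₂ _≤_ (sym (Finₚ.toℕ-fromℕ< m<n)) (sym (Finₚ.toℕ-fromℕ< m′<n)) m≤m′))
    where
    m<n = ℕₚ.≤-<-trans m≤m′ m′<n
    at : ∀ {x} (x<n : x < n) → lookup f (fromℕ< x<n) ≡ f !ℕ x
    at x<n = trans (lookup≡!ℕ f _) (cong (f !ℕ_) (Finₚ.toℕ-fromℕ< x<n))

  Bounded : Window n → Set
  Bounded π = ∀ {m} → m < n → ∣ π ! m ∣ ≤ f !ℕ m

  FixedFrom : ℕ → Window n → Set
  FixedFrom k σ = ∀ {m} → k ≤ m → m < n → σ ! m ≡ + suc m

  -- Positions are 0-based: Admissible k σ says σ ∈ 𝒟_{n,f} and σ fixes k+1, …, n.
  record Admissible (k : ℕ) (σ : Window n) : Set where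
    field
      even    : EvenSignedPermOn n (σ !_)
      bounded : Bounded σ
      fixed   : FixedFrom k σ

  open Admissible

  InDf⇒Admissible : ∀ {π} → InDf f π → Admissible n π
  InDf⇒Admissible {π} (inD , bound) = record
    { even    = InD⇒evenSignedPermOn π inD
    ; bounded = λ {m} m<n → subst₂ _≤_
        (cong ∣_∣ (trans (lookup≡! π _) (cong (π !_) (Finₚ.toℕ-fromℕ< m<n))))
        (trans (lookup≡!ℕ f _) (cong (f !ℕ_) (Finₚ.toℕ-fromℕ< m<n))) (bound (fromℕ< m<n))
    ; fixed   = λ n≤m m<n → ⊥-elim (ℕₚ.<-irrefl refl (ℕₚ.<-≤-trans m<n n≤m))
    }

  Admissible⇒InDf : ∀ {k π} → Admissible k π → InDf f π
  Admissible⇒InDf {π = π} a =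
    evenSignedPermOn⇒InD π (even a) ,
    λ i → subst₂ _≤_ (cong ∣_∣ (sym (lookup≡! π i))) (sym (lookup≡!ℕ f i)) (bounded a (Finₚ.toℕ<n i))

  -- Otherwise the first m+1 entries of some π ∈ 𝒟_{n,f} would have m+1 distinct absolute values ≤ m.
  f!-large : ∀ {m} → m < n → suc m ≤ f !ℕ m
  f!-large {m} m<n with suc m ≤? f !ℕ m
  ... | yes 1+m≤f = 1+m≤f
  ... | no 1+m≰f = ⊥-elim (signedPermOn-¬allBelow (signedPerm (even a)) m<n
          λ x≤m → ℕₚ.≤-trans (bounded a (ℕₚ.≤-<-trans x≤m m<n)) (ℕₚ.≤-trans (f!-mono x≤m m<n) f≤m))
    where
    a = InDf⇒Admissible {proj₁ nonempty} (proj₂ nonempty)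
    f≤m = ℕₚ.≤-pred (ℕₚ.≰⇒> 1+m≰f)

  -- A value v > k is fixed, i.e. sits at position v, so not at position x < k.
  admissible-∣∣≤ : ∀ {k σ x} → Admissible k σ → x < k → x < n → ∣ σ ! x ∣ ≤ k
  admissible-∣∣≤ {k} {σ} {x} a x<k x<n with ∣ σ ! x ∣ ≤? k
  ... | yes ≤k = ≤k
  ... | no ≰k = ⊥-elim (ℕₚ.<-irrefl (sym v-1≡x) (ℕₚ.<-≤-trans x<k k≤v-1))
    where
    σ′ = signedPerm (even a)
    v = ∣ σ ! x ∣
    1+[v-1]≡v : suc (v ∸ 1) ≡ v
    1+[v-1]≡v = ℕₚ.m+[n∸m]≡n (nonzero σ′ x<n)
    k≤v-1 : k ≤ v ∸ 1
    k≤v-1 = ℕₚ.≤-pred (subst (suc k ≤_) (sym 1+[v-1]≡v) (ℕₚ.≰⇒> ≰k))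
    v-1<n : v ∸ 1 < n
    v-1<n = subst (_≤ n) (sym 1+[v-1]≡v) (bounded σ′ x<n)
    v-1≡x : v ∸ 1 ≡ x
    v-1≡x = ∣∣-injective σ′ v-1<n x<n (trans (cong ∣_∣ (fixed a k≤v-1 v-1<n)) 1+[v-1]≡v)

  position-of : ∀ {k σ} → Admissible (suc k) σ → k < n → ∃ λ p → p ≤ k × ∣ σ ! p ∣ ≡ suc k
  position-of {k} {σ} a k<n with Finₚ.any? {suc k} (λ i → ∣ σ ! toℕ i ∣ ≟ suc k)
  ... | yes (i , eq) = toℕ i , ℕₚ.≤-pred (Finₚ.toℕ<n i) , eq
  ... | no none = ⊥-elim (signedPermOn-¬allBelow (signedPerm (even a)) k<n λ {x} x≤k →
          ℕₚ.≤-pred (ℕₚ.≤∧≢⇒< (admissible-∣∣≤ a (s≤s x≤k) (ℕₚ.≤-<-trans x≤k k<n)) (not-at x≤k)))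
    where
    not-at : ∀ {x} → x ≤ k → ∣ σ ! x ∣ ≢ suc k
    not-at x≤k eq = none (fromℕ< (s≤s x≤k) ,
      subst (λ y → ∣ σ ! y ∣ ≡ suc k) (sym (Finₚ.toℕ-fromℕ< (s≤s x≤k))) eq)

  j≤f!h : ∀ {j} → 1 ≤ j → j ≤ n → j ≤ f !ℕ (h j ∸ 1)
  j≤f!h {j} 1≤j j≤n with isH j 1≤j j≤n
  ... | (1≤h , h≤n , π , π∈Df , ∣π[h]∣≡j) , _ =
    subst (_≤ f !ℕ (h j ∸ 1)) ∣π[h]∣≡j
      (bounded (InDf⇒Admissible {π} π∈Df) (ℕₚ.<-≤-trans (ℕₚ.∸-monoˡ-< ℕₚ.≤-refl 1≤h) h≤n))

  h-minimal : ∀ {k σ p j} → Admissible k σ → p < n → ∣ σ ! p ∣ ≡ j → 1 ≤ j → j ≤ n → h j ≤ suc p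
  h-minimal {σ = σ} {p} {j} a p<n ∣σ[p]∣≡j 1≤j j≤n with suc p <? h j
  ... | no  p≮h = ℕₚ.≮⇒≥ p≮h
  ... | yes p<h = ⊥-elim (proj₂ (isH j 1≤j j≤n) (suc p) (s≤s z≤n) p<h σ (Admissible⇒InDf a) ∣σ[p]∣≡j)

  idD-admissible : ∀ k → Admissible k (idD n)
  idD-admissible k = record
    { even    = evenSignedPermOn-cong (λ m m<n → !-idD m m<n) record
      { signedPerm = record
        { nonzero      = λ _ → s≤s z≤n
        ; bounded      = id
        ; ∣∣-injective = λ _ _ → ℕₚ.suc-injective
        }
      ; evenNeg = subst (2 ∣_) (sym (sumBelow-zero n)) (divides 0 refl)
      }
    ; bounded = λ {m} m<n → subst (λ x → ∣ x ∣ ≤ f !ℕ m) (sym (!-idD m m<n)) (f!-large m<n)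
    ; fixed   = λ _ → !-idD _
    }

  admissible₁⇒idD : ∀ {σ} → Admissible 1 σ → σ ≡ idD n
  admissible₁⇒idD {σ} a = !-ext σ (idD n) agree
    where
    ∣∣≡1∧even⇒≡1 : ∀ x → ∣ x ∣ ≡ 1 → 2 ∣ negIndicator x → x ≡ + 1
    ∣∣≡1∧even⇒≡1 (+ suc zero) _ _   = refl
    ∣∣≡1∧even⇒≡1 -[1+ zero ]  _ 2∣1 = ⊥-elim (2≢1 (∣1⇒≡1 2∣1))
      where 2≢1 : 2 ≢ 1
            2≢1 ()
    agree : ∀ m → m < n → σ ! m ≡ idD n ! m
    agree (suc m) 1+m<n = trans (fixed a (s≤s z≤n) 1+m<n) (sym (!-idD (suc m) 1+m<n))
    agree zero    0<n with position-of a 0<n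
    ... | zero , _ , ∣σ[0]∣≡1 = trans
      (∣∣≡1∧even⇒≡1 (σ ! 0) ∣σ[0]∣≡1 (subst (2 ∣_) negatives≡ (evenNeg (even a))))
      (sym (!-idD 0 0<n))
      where
      negatives≡ : sumBelow n (negIndicator ∘ (σ !_)) ≡ negIndicator (σ ! 0)
      negatives≡ = sumBelow-head n 0<n λ 1≤m m<n → cong negIndicator (fixed a 1≤m m<n)

  module AdmissibleTerm {k p ε τ} (t : Term n k p ε τ) (k<n : k < n) where
    open TermProperties t k<n

    bounded-∘ : ∀ {σ} → Bounded σ → ∣ σ ! k ∣ ≤ f !ℕ p → Bounded (σ ∘D τ)
    bounded-∘ {σ} b ∣σ[k]∣≤f[p] {m} m<n rewrite ∣!-∘∣ σ m<n with position p k m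
    ... | at₁ refl rewrite swapℕ-at₁ m k = ∣σ[k]∣≤f[p]
    ... | at₂ _ refl rewrite swapℕ-at₂ p m = ℕₚ.≤-trans (b p<n) (f!-mono p≤k k<n)
    ... | elsewhere m≢p m≢k rewrite swapℕ-elsewhere p k m m≢p m≢k = b m<n

    fixedFrom-∘ : ∀ {σ} → FixedFrom (suc k) σ → FixedFrom (suc k) (σ ∘D τ)
    fixedFrom-∘ {σ} fix k<m m<n = trans (!-∘-above σ k<m m<n) (fix k<m m<n)

    admissible-∘ : ∀ {π} → Admissible (suc k) π → ∣ π ! p ∣ ≡ suc k → (π ∘D τ) ! k ≡ + suc k →
      Admissible k (π ∘D τ)
    admissible-∘ {π} a ∣π[p]∣≡1+k π∘τ[k]≡1+k = record
      { even    = evenSignedPermOn-∘ (even a)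
      ; bounded = bounded-∘ (bounded a)
          (ℕₚ.≤-trans (admissible-∣∣≤ a ℕₚ.≤-refl k<n) (subst (_≤ f !ℕ p) ∣π[p]∣≡1+k (bounded a p<n)))
      ; fixed   = λ k≤m → fixedFrom-k (ℕₚ.m≤n⇒m<n∨m≡n k≤m)
      }
      where
      fixedFrom-k : ∀ {m} → k < m ⊎ k ≡ m → m < n → (π ∘D τ) ! m ≡ + suc m
      fixedFrom-k (inj₁ k<m) = fixedFrom-∘ (fixed a) k<m
      fixedFrom-k (inj₂ refl) _ = π∘τ[k]≡1+k

    admissible-∘⁻¹ : ∀ {π} → h (suc k) ≤ suc p → Admissible k (π ∘D τ) → Admissible (suc k) π
    admissible-∘⁻¹ {π} h≤1+p a = subst (Admissible (suc k)) (sym (involution-move involution refl)) (back a)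
      where
      back : ∀ {σ} → Admissible k σ → Admissible (suc k) (σ ∘D τ)
      back {σ} a = record
        { even    = evenSignedPermOn-∘ (even a)
        ; bounded = bounded-∘ (bounded a) (subst (_≤ f !ℕ p) (cong ∣_∣ (sym (fixed a ℕₚ.≤-refl k<n)))
            (ℕₚ.≤-trans (j≤f!h (s≤s z≤n) k<n) (f!-mono (ℕₚ.∸-monoˡ-≤ 1 h≤1+p) p<n)))
        ; fixed   = fixedFrom-∘ (λ k<m → fixed a (ℕₚ.<⇒≤ k<m))
        }

  Θ*ZD : ℕ → ZD n → ZD n
  Θ*ZD j = Θ n h j *ZD_

  partialProduct : ℕ → ZD n
  partialProduct k = foldr Θ*ZD (oneZD n) (interval 1 k)

  Expands : ℕ → Set
  Expands k = ∀ σ → (Admissible k σ → coeff (partialProduct k) σ ≡ + 1)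
                  × (¬ Admissible k σ → coeff (partialProduct k) σ ≡ + 0)

  expands-1 : Expands 1
  expands-1 σ rewrite ∘D-identityʳ (idD n) with Vecₚ.≡-dec ℤₚ._≟_ (idD n) σ
  ... | yes refl = (λ _ → refl) , λ ¬a → ⊥-elim (¬a (idD-admissible 1))
  ... | no id≢σ  = (λ a → ⊥-elim (id≢σ (sym (admissible₁⇒idD a)))) , λ _ → refl

  module Step (k′ : ℕ) (k<n : suc k′ < n) (IH : Expands (suc k′)) where
    k = suc k′
    j = suc k

    I₁ I₂ : List ℕ
    I₁ = interval (h j) k
    I₂ = interval (h j) j

    terms : List (Window n)
    terms = idD n ∷ (mapᴸ (λ i → tD n i j) I₁ ++ mapᴸ (λ i → tDbar n i j) I₂)

    1≤h : 1 ≤ h j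
    1≤h = proj₁ (proj₁ (isH j (s≤s z≤n) k<n))

    tD-termAt : ∀ {i} → h j ≤ i → i ≤ k → Term n k (i ∸ 1) false (tD n i j)
    tD-termAt {suc i} _ i<k = tD-term i<k k<n
    tD-termAt {zero} h≤0 _ = ⊥-elim (ℕₚ.<-irrefl refl (ℕₚ.≤-trans 1≤h h≤0))

    tDbar-termAt : ∀ {i} → h j ≤ i → i ≤ j → Term n k (i ∸ 1) true (tDbar n i j)
    tDbar-termAt {zero} h≤0 _ = ⊥-elim (ℕₚ.<-irrefl refl (ℕₚ.≤-trans 1≤h h≤0))
    tDbar-termAt {suc i} _ 1+i≤j with i ≟ k
    ... | yes refl = tDbar-diag-term (s≤s z≤n) k<n
    ... | no i≢k   = tDbar-term (ℕₚ.≤∧≢⇒< (ℕₚ.≤-pred 1+i≤j) i≢k) k<n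

    h≤1+[i-1] : ∀ {i} → h j ≤ i → h j ≤ suc (i ∸ 1)
    h≤1+[i-1] {zero}  h≤0 = ℕₚ.≤-trans h≤0 z≤n
    h≤1+[i-1] {suc i} h≤i = h≤i

    AdmissibleTermOf : Window n → Set
    AdmissibleTermOf τ = ∃₂ λ p ε → Term n k p ε τ × h j ≤ suc p

    all-terms : All AdmissibleTermOf terms
    all-terms = (k , false , idD-term n k , h-minimal (idD-admissible 0) k<n (cong ∣_∣ (!-idD k k<n)) (s≤s z≤n) k<n)
      ∷ Allₚ.++⁺
          (Allₚ.map⁺ (All-interval (h j) k λ h≤i i≤k → _ , _ , tD-termAt h≤i i≤k , h≤1+[i-1] h≤i))
          (Allₚ.map⁺ (All-interval (h j) j λ h≤i i≤j → _ , _ , tDbar-termAt h≤i i≤j , h≤1+[i-1] h≤i))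

    Θ≡formalSum : Θ n h j ≡ formalSum terms
    Θ≡formalSum = cong ((+ 1 , idD n) ∷_)
      (trans (cong₂ _++_ (Listₚ.map-∘ I₁) (Listₚ.map-∘ I₂))
             (sym (Listₚ.map-++ _ (mapᴸ (λ i → tD n i j) I₁) _)))

    partialProduct-suc : partialProduct j ≡ partialProduct k *ZD formalSum terms
    partialProduct-suc = begin
      foldr Θ*ZD (oneZD n) (interval 1 j)
        ≡⟨ cong (foldr Θ*ZD (oneZD n)) (interval-snoc {1} {k} (s≤s z≤n)) ⟩
      foldr Θ*ZD (oneZD n) (interval 1 k ++ [ j ])
        ≡⟨ Listₚ.foldr-++ Θ*ZD (oneZD n) (interval 1 k) [ j ] ⟩
      foldr Θ*ZD (Θ n h j *ZD oneZD n) (interval 1 k)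
        ≡⟨ cong (λ z → foldr Θ*ZD z (interval 1 k)) Θ*1≡1*Θ ⟩
      foldr Θ*ZD (oneZD n *ZD formalSum terms) (interval 1 k)
        ≡⟨ foldr-*ZD (Θ n h) (interval 1 k) (oneZD n) (formalSum terms) ⟩
      partialProduct k *ZD formalSum terms               ∎
      where
      open ≡-Reasoning
      Θ*1≡1*Θ : Θ n h j *ZD oneZD n ≡ oneZD n *ZD formalSum terms
      Θ*1≡1*Θ = trans (*ZD-identityʳ _) (trans Θ≡formalSum (sym (*ZD-identityˡ _
        (Allₚ.map⁺ (All.map (λ (_ , _ , t , _) → TermProperties.inRange t k<n) all-terms)))))

    termCoeff : Window n → Window n → ℤ
    termCoeff π τ = coeff (partialProduct k) (π ∘D τ)

    coeff-suc : ∀ π → coeff (partialProduct j) π ≡ sumℤ (termCoeff π) terms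
    coeff-suc π = trans (cong (λ X → coeff X π) partialProduct-suc)
      (coeff-*ZD-formalSum (partialProduct k) terms
        (All.map (λ (_ , _ , t , _) → TermProperties.involution t k<n) all-terms) π)

    tD-sum tDbar-sum : Window n → ℤ
    tD-sum    π = sumℤ (λ i → termCoeff π (tD n i j)) I₁
    tDbar-sum π = sumℤ (λ i → termCoeff π (tDbar n i j)) I₂

    sum-terms : ∀ π → sumℤ (termCoeff π) terms ≡ termCoeff π (idD n) +ℤ (tD-sum π +ℤ tDbar-sum π)
    sum-terms π = cong (termCoeff π (idD n) +ℤ_)
      (trans (sumℤ-++ (termCoeff π) (mapᴸ (λ i → tD n i j) I₁) _)
             (cong₂ _+ℤ_ (sumℤ-map (termCoeff π) (λ i → tD n i j) I₁)
                         (sumℤ-map (termCoeff π) (λ i → tDbar n i j) I₂)))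

    termCoeff-inadmissible : ∀ {π τ} → ¬ Admissible j π → AdmissibleTermOf τ → termCoeff π τ ≡ + 0
    termCoeff-inadmissible ¬a (_ , _ , t , h≤1+p) =
      proj₂ (IH _) (¬a ∘ AdmissibleTerm.admissible-∘⁻¹ t k<n h≤1+p)

    expands-inadmissible : ∀ {π} → ¬ Admissible j π → sumℤ (termCoeff π) terms ≡ + 0
    expands-inadmissible ¬a = sumℤ-zero terms (All.map (termCoeff-inadmissible ¬a) all-terms)

    module _ {π} (a : Admissible j π) {p*} (p*≤k : p* ≤ k) (∣π[p*]∣≡j : ∣ π ! p* ∣ ≡ j) where
      p*<n : p* < n
      p*<n = ℕₚ.≤-<-trans p*≤k k<n

      h≤1+p* : h j ≤ suc p*
      h≤1+p* = h-minimal a p*<n ∣π[p*]∣≡j (s≤s z≤n) k<n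

      termCoeff-hit : ∀ {ε τ} → Term n k p* ε τ → negIf ε (π ! p*) ≡ + j → termCoeff π τ ≡ + 1
      termCoeff-hit t π[p*]≡j = proj₁ (IH _) (AdmissibleTerm.admissible-∘ t k<n a ∣π[p*]∣≡j
        (trans (TermProperties.!-∘-at-k t k<n π) π[p*]≡j))

      termCoeff-miss : ∀ {p ε τ} → Term n k p ε τ → (p ≡ p* → negIf ε (π ! p*) ≢ + j) → termCoeff π τ ≡ + 0
      termCoeff-miss {p} {ε} {τ} t miss = proj₂ (IH _) (hit ∘ π[p]≡j)
        where
        π[p]≡j : Admissible k (π ∘D τ) → negIf ε (π ! p) ≡ + j
        π[p]≡j a′ = trans (sym (TermProperties.!-∘-at-k t k<n π)) (fixed a′ ℕₚ.≤-refl k<n)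
        hit : negIf ε (π ! p) ≢ + j
        hit eq with ∣∣-injective (signedPerm (even a)) (TermProperties.p<n t k<n) p*<n
                      (trans (sym (∣negIf∣ ε (π ! p))) (trans (cong ∣_∣ eq) (sym ∣π[p*]∣≡j)))
        ... | refl = miss refl eq

      1+[i-1]≡i : ∀ {i} → h j ≤ i → suc (i ∸ 1) ≡ i
      1+[i-1]≡i {i} h≤i = ℕₚ.m+[n∸m]≡n (ℕₚ.≤-trans 1≤h h≤i)

      i-1≢p* : ∀ {i} → h j ≤ i → i ≢ suc p* → i ∸ 1 ≢ p*
      i-1≢p* h≤i i≢1+p* i-1≡p* = i≢1+p* (trans (sym (1+[i-1]≡i h≤i)) (cong suc i-1≡p*))

      tD-hits : π ! p* ≡ + j → p* < k → tD-sum π ≡ + 1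
      tD-hits π[p*]≡j p*<k = sumℤ-interval-point _ (h j) k (suc p*) h≤1+p* p*<k
        (termCoeff-hit (tD-termAt h≤1+p* p*<k) π[p*]≡j)
        λ h≤i i≤k i≢1+p* → termCoeff-miss (tD-termAt h≤i i≤k) (⊥-elim ∘ i-1≢p* h≤i i≢1+p*)

      tDbar-hits : π ! p* ≡ -[1+ k ] → tDbar-sum π ≡ + 1
      tDbar-hits π[p*]≡-j = sumℤ-interval-point _ (h j) j (suc p*) h≤1+p* (s≤s p*≤k)
        (termCoeff-hit (tDbar-termAt h≤1+p* (s≤s p*≤k)) (cong -_ π[p*]≡-j))
        λ h≤i i≤j i≢1+p* → termCoeff-miss (tDbar-termAt h≤i i≤j) (⊥-elim ∘ i-1≢p* h≤i i≢1+p*)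

      tD-misses : (∀ {i} → h j ≤ i → i ≤ k → i ∸ 1 ≡ p* → π ! p* ≢ + j) → tD-sum π ≡ + 0
      tD-misses miss = sumℤ-zero I₁
        (All-interval (h j) k λ h≤i i≤k → termCoeff-miss (tD-termAt h≤i i≤k) (miss h≤i i≤k))

      tDbar-misses : - (π ! p*) ≢ + j → tDbar-sum π ≡ + 0
      tDbar-misses miss = sumℤ-zero I₂
        (All-interval (h j) j λ h≤i i≤j → termCoeff-miss (tDbar-termAt h≤i i≤j) λ _ → miss)

      -- The one term that hits: idD if π(k+1) = k+1, some t_{i,k+1} if +(k+1) sits further left,
      -- and some t_{ī,k+1} if −(k+1) appears.
      expands-admissible : sumℤ (termCoeff π) terms ≡ + 1
      expands-admissible with ∣∣≡suc⇒± (π ! p*) ∣π[p*]∣≡j | ℕₚ.m≤n⇒m<n∨m≡n p*≤k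
      ... | inj₂ π[p*]≡-j | _ = trans (sum-terms π) (cong₂ _+ℤ_
        (termCoeff-miss (idD-term n k) λ _ → -[1+]≢+ π[p*]≡-j)
        (cong₂ _+ℤ_ (tD-misses λ _ _ _ → -[1+]≢+ π[p*]≡-j) (tDbar-hits π[p*]≡-j)))
      ... | inj₁ π[p*]≡j | inj₂ refl = trans (sum-terms π) (cong₂ _+ℤ_
        (termCoeff-hit (idD-term n k) π[p*]≡j)
        (cong₂ _+ℤ_ (tD-misses λ h≤i i≤k i-1≡k _ → ℕₚ.<-irrefl i-1≡k (subst (_≤ k) (sym (1+[i-1]≡i h≤i)) i≤k))
                    (tDbar-misses (-≢+ π[p*]≡j))))
      ... | inj₁ π[p*]≡j | inj₁ p*<k = trans (sum-terms π) (cong₂ _+ℤ_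
        (termCoeff-miss (idD-term n k) λ k≡p* _ → ℕₚ.<-irrefl (sym k≡p*) p*<k)
        (cong₂ _+ℤ_ (tD-hits π[p*]≡j p*<k) (tDbar-misses (-≢+ π[p*]≡j))))

    expands-suc : Expands j
    expands-suc π =
      (λ a → let p* , p*≤k , ∣π[p*]∣≡j = position-of a k<n in
             trans (coeff-suc π) (expands-admissible a p*≤k ∣π[p*]∣≡j)) ,
      (λ ¬a → trans (coeff-suc π) (expands-inadmissible ¬a))

  expands : ∀ k → 1 ≤ k → k ≤ n → Expands k
  expands (suc zero)     _ _   = expands-1
  expands (suc (suc k′)) _ k<n = Step.expands-suc k′ k<n (expands (suc k′) (s≤s z≤n) (ℕₚ.<⇒≤ k<n))

lemma6p6 : (n : ℕ) → 1 ≤ n → (f : Vec ℕ n) →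
    (∀ (i : Fin n) → 1 ≤ lookup f i × lookup f i ≤ n) →
    (∀ (i j : Fin n) → i Data.Fin.≤ j → lookup f i ≤ lookup f j) →
    ∃ (λ π → InDf f π) →
    (h : ℕ → ℕ) → IsH n f h →
    ∀ (π : Window n) → InD π →
    (InDf f π → coeff (ΘProd n h) π ≡ + 1) × (¬ InDf f π → coeff (ΘProd n h) π ≡ + 0)
lemma6p6 n 1≤n f _ f-mono nonempty h isH π _ =
  (λ π∈Df → proj₁ (expands n 1≤n ℕₚ.≤-refl π) (InDf⇒Admissible π∈Df)) ,
  (λ π∉Df → proj₂ (expands n 1≤n ℕₚ.≤-refl π) (π∉Df ∘ Admissible⇒InDf))
  where open Expansion n f f-mono nonempty h isH
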